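{- Let $\nu$ be any partition and set $\overline{\nu}:=\lambda(0,\nu)$ and $\underline{\nu}:=\rho(0,\nu)$, where $0$ is the empty partition. Then $\Delta(\overline{\nu})$ is the reverse reading word of an LR-filling of the skew shape $\nu/\underline{\nu}$ of type $\overline{\nu}$.
   Context: Partitions are weakly decreasing sequences of nonnegative integers, identified up to trailing zeros; diagrams use French convention (row 1 at bottom, cells $(x,y)$ with column $x$ and row $y$). For partitions $\mu,\nu$ written as $n$-tuples, the $*$-operation is $(\mu,\nu)^*=(\lambda(\mu,\nu),\rho(\mu,\nu))$ with $\lambda_k=\mu_k-k+\#\{j\in\{1,\dots,n\}: \nu_j-j\ge \mu_k-k\}$ and $\rho_j=\nu_j-j+1+\#\{k\in\{1,\dots,n\}:\mu_k-k>\nu_j-j\}$. The natural filling of a partition $\mu$ puts the entry $y$ in every cell of row $y$. For a partition $\mu$, $\Delta(\mu)$ is the word obtained from the natural filling of $\mu$ by reading, for $k=1,2,\dots$ in turn, the entries of the cells $(x,y)$ of $\mu$ with $x+y=k+1$, in decreasing order of the row $y$ (from top-left to bottom-right); e.g. $\Delta(44432211)=1\,21\,321\,4321\,5432\,6543\,76\,8$. A semistandard tableau of skew shape $\theta/\nu$ has entries weakly increasing along rows and strictly increasing up columns; its type is the sequence $(m_1,m_2,\dots)$ with $m_i$ the number of entries equal to $i$. Its reading word lists entries row by row from the top row to the bottom row, each row left to right; the reverse reading word is this word read backwards. A lattice permutation is a word in positive integers such that in every prefix the number of $i$'s is at least the number of $(i+1)$'s for every $i$. An LR-filling is a semistandard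 tableau of skew shape whose reverse reading word is a lattice permutation. -}

module Defs where

open import Data.Bool using (Bool; true; false)
open import Data.Nat as ℕ using (ℕ; zero; suc; _+_; _∸_; _≤_; _<_)
open import Data.Integer as ℤ using (ℤ; +_; ∣_∣)
open import Data.List using (List; []; _∷_; map; upTo; length; filterᵇ; concatMap; reverse; take)
open import Data.Product using (Σ; _×_)
open import Relation.Binary.PropositionalEquality using (_≡_)

-- 1-indexed access to a finite sequence, with value 0 outside 1..length
-- (partitions are identified up to trailing zeros).
at₀ : List ℕ → ℕ → ℕ
at₀ []       _       = 0
at₀ (x ∷ xs) zero    = x
at₀ (x ∷ xs) (suc k) = at₀ xs k

at : List ℕ → ℕ → ℕ
at xs zero    = 0
at xs (suc k) = at₀ xs k

range : ℕ → List ℕ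
range n = map suc (upTo n)

count : (ℕ → Bool) → List ℕ → ℕ
count p xs = length (filterᵇ p xs)

IsPartition : List ℕ → Set
IsPartition ν = ∀ i → at ν (suc (suc i)) ≤ at ν (suc i)

shifted : List ℕ → ℕ → ℤ
shifted ν j = (+ at ν j) ℤ.- (+ j)

starλ : ℕ → List ℕ → List ℕ → ℕ → ℤ
starλ n μ ν k = shifted μ k ℤ.+ (+ count (λ j → shifted μ k ℤ.≤ᵇ shifted ν j) (range n))

starρ : ℕ → List ℕ → List ℕ → ℕ → ℤ
starρ n μ ν j = shifted ν j ℤ.+ (+ 1) ℤ.+ (+ count (λ k → (shifted ν j ℤ.+ (+ 1)) ℤ.≤ᵇ shifted μ k) (range n))

-- λ(μ,ν) and ρ(μ,ν) as n-tuples (entries are nonnegative, so ∣_∣ is exact).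
lambdaStar : ℕ → List ℕ → List ℕ → List ℕ
lambdaStar n μ ν = map (λ k → ∣ starλ n μ ν k ∣) (range n)

rhoStar : ℕ → List ℕ → List ℕ → List ℕ
rhoStar n μ ν = map (λ j → ∣ starρ n μ ν j ∣) (range n)

-- the empty partition 0 (as an n-tuple of zeros; `at` pads with zeros)
emptyPartition : List ℕ
emptyPartition = []

nuBar : List ℕ → List ℕ
nuBar ν = lambdaStar (length ν) emptyPartition ν

nuUnder : List ℕ → List ℕ
nuUnder ν = rhoStar (length ν) emptyPartition ν

-- Δ(μ): for k = 1, 2, ..., K, the entries y of the natural filling in cells
-- (x,y) ∈ μ with x + y = k + 1, in decreasing order of y.
-- Cell (k+1-y, y) (1 ≤ y ≤ k) lies in μ iff k + 1 ≤ μ_y + y.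
-- K = μ_1 + length μ is beyond the last nonempty diagonal.
diagonal : List ℕ → ℕ → List ℕ
diagonal μ k = filterᵇ (λ y → suc k ℕ.≤ᵇ at μ y + y) (reverse (range k))

Δ : List ℕ → List ℕ
Δ μ = concatMap (diagonal μ) (range (at μ 1 + length μ))

InSkew : List ℕ → List ℕ → ℕ → ℕ → Set
InSkew θ κ x y = (1 ≤ y) × (at κ y < x) × (x ≤ at θ y)

-- A filling assigns T x y to cell (x,y) (values outside the shape are irrelevant).
record IsSemistandard (θ κ : List ℕ) (T : ℕ → ℕ → ℕ) : Set where
  field
    positive : ∀ x y → InSkew θ κ x y → 1 ≤ T x y
    rowWeak  : ∀ x y → InSkew θ κ x y → InSkew θ κ (suc x) y → T x y ≤ T (suc x) y
    colStrict : ∀ x y → InSkew θ κ x y → InSkew θ κ x (suc y) → T x y < T x (suc y)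

rowCells : List ℕ → List ℕ → ℕ → List ℕ
rowCells θ κ y = map (λ i → at κ y + i) (range (at θ y ∸ at κ y))

-- reading word: rows from top to bottom, each row left to right
readingWord : List ℕ → List ℕ → (ℕ → ℕ → ℕ) → List ℕ
readingWord θ κ T = concatMap (λ y → map (λ x → T x y) (rowCells θ κ y)) (reverse (range (length θ)))

reverseReadingWord : List ℕ → List ℕ → (ℕ → ℕ → ℕ) → List ℕ
reverseReadingWord θ κ T = reverse (readingWord θ κ T)

occ : ℕ → List ℕ → ℕ
occ i w = count (λ a → a ℕ.≡ᵇ i) w

HasType : List ℕ → List ℕ → (ℕ → ℕ → ℕ) → List ℕ → Set
HasType θ κ T α = ∀ i → 1 ≤ i → occ i (readingWord θ κ T) ≡ at α i

IsLatticePermutation : List ℕ → Set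
IsLatticePermutation w = ∀ m i → 1 ≤ i → occ (suc i) (take m w) ≤ occ i (take m w)

record IsLRFilling (θ κ : List ℕ) (T : ℕ → ℕ → ℕ) : Set where
  field
    semistandard : IsSemistandard θ κ T
    lattice      : IsLatticePermutation (reverseReadingWord θ κ T)

-- Fill the cell (x, y) of ν/ν̲ with x + y − 1 − ν_y.  Read from right to left, row k + 1
-- is the run k, k − 1, …, k − min(k, ν_{k+1}) + 1.  The cells (x, y) on the k-th
-- diagonal of ν̄ are those with ν̄_y + y ≥ k + 1, and ν̄_y + y counts the indices j with
-- ν_j − j ≥ −y; as ν is a partition these form an initial segment, so the condition
-- becomes ν_{k+1} + y ≥ k + 1 and the diagonal is the same run.  Hence the reverse
-- reading word (rows bottom to top, each right to left) is Δ(ν̄).  The run of row k + 1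
-- contains i exactly when i ≤ k and ν_{k+1} + i ≥ k + 1; the second condition alone holds
-- for ν̄_i + i values of k, i of them with k < i, so i occurs ν̄_i times.  Finally, since
-- ν_{k+2} ≤ ν_{k+1}, every i + 1 in row k + 2 is matched by an i in row k + 1, which gives
-- the lattice property.

module Submission where

open import Defs
open import Data.Bool using (Bool; true; false; T; _∧_; not)
open import Data.Bool.Properties using (∧-zeroʳ; ∧-identityʳ; T-∧)
open import Data.Empty using (⊥-elim)
open import Data.Nat as ℕ using (ℕ; zero; suc; _+_; _∸_; _≤_; _<_; _⊓_; z≤n; s≤s; _≤ᵇ_; _≡ᵇ_)
open import Data.Nat.Properties
open import Data.Integer as ℤ using (∣_∣)
import Data.Integer.Properties as ℤₚ
open import Data.Integer.Tactic.RingSolver using (solve-∀)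
open import Data.List using (List; []; _∷_; _++_; map; upTo; applyUpTo; downFrom; length; filterᵇ; concatMap; reverse; take; drop; _∷ʳ_; [_]; concat)
open import Data.List.Properties using (filter-++; length-++; map-++; ++-identityʳ; ++-assoc; reverse-++; upTo-∷ʳ; reverse-map; reverse-upTo; concat-++; filter-accept; filter-reject; take++drop≡id; take-[]; map-∘; map-upTo; map-cong; length-applyUpTo)
open import Data.List.Relation.Binary.Permutation.Propositional.Properties using (↭-length; filter-↭; ↭-reverse)
open import Data.Product using (Σ; ∃-syntax; _×_; _,_; proj₂)
open import Data.Sum as Sum using (_⊎_; inj₁; inj₂)
open import Algebra.Properties.CommutativeSemigroup +-commutativeSemigroup using (interchange; xy∙z≈xz∙y)
open import Function using (_∘_; _⇔_; mk⇔; Equivalence)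
open import Function.Properties.Equivalence using () renaming (trans to ⇔-trans; sym to ⇔-sym)
open import Data.Product.Function.NonDependent.Propositional using (_×-⇔_)
open import Relation.Nullary using (¬_; yes; no; T?)
open import Relation.Nullary.Decidable using (decidable-stable)
open import Relation.Binary.PropositionalEquality hiding ([_])

open Equivalence using (to; from)

iverson : Bool → ℕ
iverson true  = 1
iverson false = 0

T-injective : ∀ {a b} → T a ⇔ T b → a ≡ b
T-injective {false} {false} _ = refl
T-injective {false} {true}  a⇔b = ⊥-elim (from a⇔b _)
T-injective {true}  {false} a⇔b = ⊥-elim (to a⇔b _)
T-injective {true}  {true}  _ = refl

T-≤ᵇ : ∀ {m n} → T (m ≤ᵇ n) ⇔ m ≤ n
T-≤ᵇ {m} {n} = mk⇔ (≤ᵇ⇒≤ m n) ≤⇒≤ᵇ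

≤ᵇ≡true : ∀ {m n} → m ≤ n → (m ≤ᵇ n) ≡ true
≤ᵇ≡true m≤n = T-injective (mk⇔ (λ _ → _) (λ _ → ≤⇒≤ᵇ m≤n))

≤ᵇ≡false : ∀ {m n} → ¬ m ≤ n → (m ≤ᵇ n) ≡ false
≤ᵇ≡false {m} {n} m≰n = T-injective (mk⇔ (m≰n ∘ ≤ᵇ⇒≤ m n) (λ ()))

≤ᵇ-≡ : ∀ {a b c d} → (a ≤ b ⇔ c ≤ d) → (a ≤ᵇ b) ≡ (c ≤ᵇ d)
≤ᵇ-≡ e = T-injective (⇔-trans T-≤ᵇ (⇔-trans e (⇔-sym T-≤ᵇ)))

iverson-T : ∀ {b} → T b → iverson b ≡ 1
iverson-T {true} _ = refl

iverson-¬T : ∀ {b} → ¬ T b → iverson b ≡ 0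
iverson-¬T {false} _  = refl
iverson-¬T {true}  ¬t = ⊥-elim (¬t _)

iverson-≤ : ∀ {a b} → (T a → T b) → iverson a ≤ iverson b
iverson-≤ {false}          _ = z≤n
iverson-≤ {true}  {true}  _ = ≤-refl
iverson-≤ {true}  {false} f = ⊥-elim (f _)

iverson-∧ : ∀ a b → iverson a ≡ iverson (a ∧ b) + iverson (a ∧ not b)
iverson-∧ true  true  = refl
iverson-∧ true  false = refl
iverson-∧ false _     = refl

m∸n<o⇒m<n+o : ∀ m n {o} → m ∸ n < o → m < n + o
m∸n<o⇒m<n+o m n m∸n<o = ≤-<-trans (m≤n+m∸n m n) (+-monoʳ-< n m∸n<o)

<+⇔∸< : ∀ k r y .{{_ : ℕ.NonZero y}} → k < r + y ⇔ k ∸ r < y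
<+⇔∸< k r y = mk⇔ (m<n+o⇒m∸n<o k r) (m∸n<o⇒m<n+o k r)

m+n≤o⇔m≤o∸n : ∀ m n o .{{_ : ℕ.NonZero m}} → m + n ≤ o ⇔ m ≤ o ∸ n
m+n≤o⇔m≤o∸n m n o = mk⇔ (m+n≤o⇒m≤o∸n m) (λ m≤o∸n → m≤o∸n⇒m+n≤o m (n≤o m≤o∸n) m≤o∸n)
  where
  n≤o : m ≤ o ∸ n → n ≤ o
  n≤o m≤o∸n = <⇒≤ (m∸n≢0⇒n<m (>⇒≢ (<-≤-trans (ℕ.>-nonZero⁻¹ m) m≤o∸n)))

[m+[n∸m]]∸n≡m∸n : ∀ m n → (m + (n ∸ m)) ∸ n ≡ m ∸ n
[m+[n∸m]]∸n≡m∸n m n with m ≤? n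
... | yes m≤n rewrite m+[n∸m]≡n m≤n | n∸n≡0 n = sym (m≤n⇒m∸n≡0 m≤n)
... | no  m≰n rewrite m≤n⇒m∸n≡0 (<⇒≤ (≰⇒> m≰n)) | +-identityʳ m = refl

[m∸n+o+n]∸m≡o+[n∸m] : ∀ m n o → ((m ∸ n) + o + n) ∸ m ≡ o + (n ∸ m)
[m∸n+o+n]∸m≡o+[n∸m] m n o with m ≤? n
... | yes m≤n rewrite m≤n⇒m∸n≡0 m≤n = +-∸-assoc o m≤n
... | no  m≰n = begin
  (m ∸ n) + o + n ∸ m ≡⟨ cong (_∸ m) (xy∙z≈xz∙y (m ∸ n) o n) ⟩
  (m ∸ n) + n + o ∸ m ≡⟨ cong (λ l → l + o ∸ m) (m∸n+n≡m n≤m) ⟩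
  m + o ∸ m           ≡⟨ m+n∸m≡n m o ⟩
  o                   ≡⟨ +-identityʳ o ⟨
  o + 0               ≡⟨ cong (o +_) (m≤n⇒m∸n≡0 n≤m) ⟨
  o + (n ∸ m)         ∎
  where
  open ≡-Reasoning
  n≤m = <⇒≤ (≰⇒> m≰n)

m∸[m∸n]≡n⊓m : ∀ m n → m ∸ (m ∸ n) ≡ n ⊓ m
m∸[m∸n]≡n⊓m m n = begin
  m ∸ (m ∸ n)                   ≡⟨ cong (_∸ (m ∸ n)) (m⊓n+n∸m≡n n m) ⟨
  (n ⊓ m) + (m ∸ n) ∸ (m ∸ n)   ≡⟨ m+n∸n≡m (n ⊓ m) (m ∸ n) ⟩
  n ⊓ m                         ∎
  where open ≡-Reasoning

module _ where
  open ℤ using (+_)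

  [+a-+b]≤ᵇ[+c-+d] : ∀ a b c d → ((+ a ℤ.- + b) ℤ.≤ᵇ (+ c ℤ.- + d)) ≡ (a + d ≤ᵇ c + b)
  [+a-+b]≤ᵇ[+c-+d] a b c d = T-injective (mk⇔
    (≤⇒≤ᵇ ∘ ℤₚ.drop‿+≤+ ∘ ℤₚ.0≤i-j⇒j≤i {+ (c + b)} {+ (a + d)} ∘ subst (ℤ._≤_ (+ 0)) difference ∘ ℤₚ.i≤j⇒0≤j-i {x} {y} ∘ ℤₚ.≤ᵇ⇒≤)
    (ℤₚ.≤⇒≤ᵇ ∘ ℤₚ.0≤i-j⇒j≤i {y} {x} ∘ subst (ℤ._≤_ (+ 0)) (sym difference) ∘ ℤₚ.i≤j⇒0≤j-i ∘ ℤ.+≤+ ∘ ≤ᵇ⇒≤ (a + d) (c + b)))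
    where
    x = + a ℤ.- + b
    y = + c ℤ.- + d
    rearrange : ∀ (a b c d : ℤ.ℤ) → (c ℤ.- d) ℤ.- (a ℤ.- b) ≡ (c ℤ.+ b) ℤ.- (a ℤ.+ d)
    rearrange = solve-∀
    difference : y ℤ.- x ≡ + (c + b) ℤ.- + (a + d)
    difference = rearrange (+ a) (+ b) (+ c) (+ d)

  ∣[+a-+b]+c∣ : ∀ a b c → b ≤ a + c → ∣ (+ a ℤ.- + b) ℤ.+ + c ∣ ≡ a + c ∸ b
  ∣[+a-+b]+c∣ a b c b≤a+c = cong ∣_∣ (begin
    (+ a ℤ.- + b) ℤ.+ + c ≡⟨ rearrange (+ a) (+ b) (+ c) ⟩
    + (a + c) ℤ.- + b     ≡⟨ ℤₚ.[+m]-[+n]≡m⊖n (a + c) b ⟩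
    (a + c) ℤ.⊖ b         ≡⟨ ℤₚ.⊖-≥ b≤a+c ⟩
    + (a + c ∸ b)         ∎)
    where
    open ≡-Reasoning
    rearrange : ∀ (a b c : ℤ.ℤ) → (a ℤ.- b) ℤ.+ c ≡ (a ℤ.+ c) ℤ.- b
    rearrange = solve-∀

at₀-≥ : ∀ xs {i} → length xs ≤ i → at₀ xs i ≡ 0
at₀-≥ []       _         = refl
at₀-≥ (x ∷ xs) (s≤s len≤i) = at₀-≥ xs len≤i

map-range : ∀ (f : ℕ → ℕ) n → map f (range n) ≡ applyUpTo (f ∘ suc) n
map-range f n = trans (sym (map-∘ (upTo n))) (map-upTo (f ∘ suc) n)

length-map-range : ∀ (f : ℕ → ℕ) n → length (map f (range n)) ≡ n
length-map-range f n = trans (cong length (map-range f n)) (length-applyUpTo (f ∘ suc) n)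

at-map-range : ∀ (f : ℕ → ℕ) {n i} → i < n → at (map f (range n)) (suc i) ≡ f (suc i)
at-map-range f {n} {i} i<n rewrite map-range f n = at₀-applyUpTo (f ∘ suc) i<n
  where
  at₀-applyUpTo : ∀ (h : ℕ → ℕ) {n i} → i < n → at₀ (applyUpTo h n) i ≡ h i
  at₀-applyUpTo h {suc n} {zero}  _   = refl
  at₀-applyUpTo h {suc n} {suc i} i<n = at₀-applyUpTo (h ∘ suc) (≤-pred i<n)

at-map-range-≥ : ∀ (f : ℕ → ℕ) {n i} → n ≤ i → at (map f (range n)) (suc i) ≡ 0
at-map-range-≥ f {n} n≤i = at₀-≥ (map f (range n)) (subst (_≤ _) (sym (length-map-range f n)) n≤i)

-- Counting

count-∷ : ∀ p x xs → count p (x ∷ xs) ≡ iverson (p x) + count p xs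
count-∷ p x xs with p x
... | true  = refl
... | false = refl

count-++ : ∀ p xs ys → count p (xs ++ ys) ≡ count p xs + count p ys
count-++ p xs ys = trans (cong length (filter-++ (T? ∘ p) xs ys)) (length-++ (filterᵇ p xs))

count-reverse : ∀ p xs → count p (reverse xs) ≡ count p xs
count-reverse p xs = ↭-length (filter-↭ (T? ∘ p) (↭-reverse xs))

count-take : ∀ p m xs → count p (take m xs) ≤ count p xs
count-take p m xs = begin
  count p (take m xs)                       ≤⟨ m≤m+n _ _ ⟩
  count p (take m xs) + count p (drop m xs) ≡⟨ count-++ p (take m xs) (drop m xs) ⟨
  count p (take m xs ++ drop m xs)          ≡⟨ cong (count p) (take++drop≡id m xs) ⟩
  count p xs                                ∎
  where open ≤-Reasoning

range-suc : ∀ n → range (suc n) ≡ range n ∷ʳ suc n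
range-suc n = trans (cong (map suc) (sym (upTo-∷ʳ n))) (map-++ suc (upTo n) [ n ])

countBelow : (ℕ → Bool) → ℕ → ℕ
countBelow p zero    = 0
countBelow p (suc n) = countBelow p n + iverson (p n)

count-range : ∀ p n → count p (range n) ≡ countBelow (p ∘ suc) n
count-range p zero    = refl
count-range p (suc n) = begin
  count p (range (suc n))               ≡⟨ cong (count p) (range-suc n) ⟩
  count p (range n ∷ʳ suc n)            ≡⟨ count-++ p (range n) [ suc n ] ⟩
  count p (range n) + count p [ suc n ] ≡⟨ cong₂ _+_ (count-range p n) (count-∷ p (suc n) []) ⟩
  countBelow (p ∘ suc) n + (iverson (p (suc n)) + 0) ≡⟨ cong (countBelow (p ∘ suc) n +_) (+-identityʳ _) ⟩
  countBelow (p ∘ suc) (suc n)          ∎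
  where open ≡-Reasoning

countBelow-cong : ∀ {p q} n → (∀ k → k < n → p k ≡ q k) → countBelow p n ≡ countBelow q n
countBelow-cong zero    _   = refl
countBelow-cong (suc n) p≡q = cong₂ _+_ (countBelow-cong n (λ k k<n → p≡q k (m≤n⇒m≤1+n k<n))) (cong iverson (p≡q n ≤-refl))

countBelow-mono : ∀ {p q} n → (∀ k → k < n → T (p k) → T (q k)) → countBelow p n ≤ countBelow q n
countBelow-mono zero    _   = z≤n
countBelow-mono (suc n) p⇒q = +-mono-≤ (countBelow-mono n (λ k k<n → p⇒q k (m≤n⇒m≤1+n k<n))) (iverson-≤ (p⇒q n ≤-refl))

countBelow≤n : ∀ p n → countBelow p n ≤ n
countBelow≤n p zero    = z≤n
countBelow≤n p (suc n) = subst (countBelow p n + iverson (p n) ≤_) (+-comm n 1) (+-mono-≤ (countBelow≤n p n) (iverson-≤1 (p n)))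
  where
  iverson-≤1 : ∀ b → iverson b ≤ 1
  iverson-≤1 true  = ≤-refl
  iverson-≤1 false = z≤n

countBelow-suc : ∀ p n → countBelow p (suc n) ≡ iverson (p 0) + countBelow (p ∘ suc) n
countBelow-suc p zero    = +-comm 0 _
countBelow-suc p (suc n) = trans (cong (_+ iverson (p (suc n))) (countBelow-suc p n)) (+-assoc (iverson (p 0)) _ _)

countBelow-all : ∀ p n → (∀ k → k < n → T (p k)) → countBelow p n ≡ n
countBelow-all p zero    _ = refl
countBelow-all p (suc n) all rewrite countBelow-all p n (λ k k<n → all k (m≤n⇒m≤1+n k<n)) with p n | all n ≤-refl
... | true | _ = +-comm n 1

countBelow-none : ∀ p n → (∀ k → k < n → ¬ T (p k)) → countBelow p n ≡ 0
countBelow-none p zero    _ = refl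
countBelow-none p (suc n) none rewrite countBelow-none p n (λ k k<n → none k (m≤n⇒m≤1+n k<n)) = iverson-¬T (none n ≤-refl)

countBelow-split : ∀ (p q : ℕ → Bool) n →
  countBelow p n ≡ countBelow (λ k → p k ∧ q k) n + countBelow (λ k → p k ∧ not (q k)) n
countBelow-split p q zero    = refl
countBelow-split p q (suc n) = trans
  (cong₂ _+_ (countBelow-split p q n) (iverson-∧ (p n) (q n)))
  (interchange (countBelow (λ k → p k ∧ q k) n) _ _ _)

countBelow-< : ∀ i n → i ≤ n → countBelow (λ k → suc k ≤ᵇ i) n ≡ i
countBelow-< i zero    z≤n = refl
countBelow-< i (suc n) i≤1+n with i ≟ suc n
... | yes refl = countBelow-all _ (suc n) (λ k → ≤⇒≤ᵇ)
... | no  i≢1+n = begin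
  countBelow (λ k → suc k ≤ᵇ i) n + iverson (suc n ≤ᵇ i) ≡⟨ cong₂ _+_ (countBelow-< i n i≤n) (iverson-¬T (n≮i ∘ ≤ᵇ⇒≤ (suc n) i)) ⟩
  i + 0                                                   ≡⟨ +-identityʳ i ⟩
  i                                                       ∎
  where
  open ≡-Reasoning
  i≤n = ≤-pred (≤∧≢⇒< i≤1+n i≢1+n)
  n≮i = λ n<i → i≢1+n (≤-antisym i≤1+n n<i)

DownwardClosed : (ℕ → Bool) → Set
DownwardClosed p = ∀ k → T (p (suc k)) → T (p k)

module _ {p : ℕ → Bool} (closed : DownwardClosed p) where

  downwardClosed-≤ : ∀ {k t} → k ≤ t → T (p t) → T (p k)
  downwardClosed-≤ {k} {t} k≤t pt with k ≟ t
  ... | yes refl = pt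
  downwardClosed-≤ {k} {suc t} k≤t pt | no k≢t = downwardClosed-≤ (≤-pred (≤∧≢⇒< k≤t k≢t)) (closed t pt)
  downwardClosed-≤ {k} {zero} z≤n pt | no k≢t = pt

  T⇒<countBelow : ∀ {t n} → t < n → T (p t) → t < countBelow p n
  T⇒<countBelow {t} {n} t<n pt = begin
    suc t                    ≡⟨ countBelow-all p (suc t) (λ k k<1+t → downwardClosed-≤ (≤-pred k<1+t) pt) ⟨
    countBelow p (suc t)     ≤⟨ countBelow-monoʳ t<n ⟩
    countBelow p n           ∎
    where
    open ≤-Reasoning
    countBelow-monoʳ : ∀ {m n} → m ≤ n → countBelow p m ≤ countBelow p n
    countBelow-monoʳ {n = zero} z≤n = ≤-refl
    countBelow-monoʳ {m} {suc n} m≤1+n with m ≟ suc n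
    ... | yes refl = ≤-refl
    ... | no m≢1+n = ≤-trans (countBelow-monoʳ (≤-pred (≤∧≢⇒< m≤1+n m≢1+n))) (m≤m+n _ _)

  ¬T⇒countBelow≤ : ∀ {t} n → ¬ T (p t) → countBelow p n ≤ t
  ¬T⇒countBelow≤ zero _ = z≤n
  ¬T⇒countBelow≤ {t} (suc n) ¬pt with n <? t
  ... | yes n<t = ≤-trans (countBelow≤n p (suc n)) n<t
  ... | no  n≮t = begin
    countBelow p n + iverson (p n) ≡⟨ cong (countBelow p n +_) (iverson-¬T (¬pt ∘ downwardClosed-≤ (≮⇒≥ n≮t))) ⟩
    countBelow p n + 0             ≡⟨ +-identityʳ _ ⟩
    countBelow p n                 ≤⟨ ¬T⇒countBelow≤ n ¬pt ⟩
    t                              ∎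
    where open ≤-Reasoning

-- Segments and blocks of words

descending : ℕ → List ℕ
descending k = map suc (downFrom k)

reverse-range : ∀ n → reverse (range n) ≡ descending n
reverse-range n = trans (sym (reverse-map suc (upTo n))) (cong (map suc) (reverse-upTo n))

segment : ℕ → ℕ → List ℕ
segment a b = map (_+ a) (descending (b ∸ a))

segment-≥ : ∀ {a b} → b ≤ a → segment a b ≡ []
segment-≥ b≤a rewrite m≤n⇒m∸n≡0 b≤a = refl

segment-suc : ∀ {a b} → a ≤ b → segment a (suc b) ≡ suc b ∷ segment a b
segment-suc {a} {b} a≤b rewrite +-∸-assoc 1 a≤b = cong (λ c → suc c ∷ segment a b) (m∸n+n≡m a≤b)

filter-descending : ∀ a b → filterᵇ (λ y → suc a ≤ᵇ y) (descending b) ≡ segment a b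
filter-descending a zero = sym (segment-≥ z≤n)
filter-descending a (suc b) with a ≤? b
... | yes a≤b = begin
  filterᵇ (λ y → suc a ≤ᵇ y) (suc b ∷ descending b) ≡⟨ filter-accept (T? ∘ (λ y → suc a ≤ᵇ y)) {x = suc b} {xs = descending b} (≤⇒≤ᵇ (s≤s a≤b)) ⟩
  suc b ∷ filterᵇ (λ y → suc a ≤ᵇ y) (descending b) ≡⟨ cong (suc b ∷_) (filter-descending a b) ⟩
  suc b ∷ segment a b                               ≡⟨ segment-suc a≤b ⟨
  segment a (suc b)                                 ∎
  where open ≡-Reasoning
... | no  a≰b = begin
  filterᵇ (λ y → suc a ≤ᵇ y) (suc b ∷ descending b) ≡⟨ filter-reject (T? ∘ (λ y → suc a ≤ᵇ y)) {x = suc b} {xs = descending b} (a≰b ∘ ≤-pred ∘ ≤ᵇ⇒≤ (suc a) (suc b)) ⟩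
  filterᵇ (λ y → suc a ≤ᵇ y) (descending b)         ≡⟨ filter-descending a b ⟩
  segment a b                                       ≡⟨ segment-≥ (<⇒≤ (≰⇒> a≰b)) ⟩
  []                                                ≡⟨ segment-≥ (≰⇒> a≰b) ⟨
  segment a (suc b)                                 ∎
  where open ≡-Reasoning

filterᵇ-descending-cong : ∀ (p q : ℕ → Bool) k → (∀ y → 1 ≤ y → y ≤ k → p y ≡ q y) → filterᵇ p (descending k) ≡ filterᵇ q (descending k)
filterᵇ-descending-cong p q zero    _   = refl
filterᵇ-descending-cong p q (suc k) p≡q with p (suc k) | q (suc k) | p≡q (suc k) (s≤s z≤n) ≤-refl
... | true  | true  | refl = cong (suc k ∷_) (filterᵇ-descending-cong p q k (λ y 1≤y y≤k → p≡q y 1≤y (m≤n⇒m≤1+n y≤k)))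
... | false | false | refl = filterᵇ-descending-cong p q k (λ y 1≤y y≤k → p≡q y 1≤y (m≤n⇒m≤1+n y≤k))

occ-segment : ∀ a b {i} (q : Bool) → T q ⇔ (a < i × i ≤ b) → occ i (segment a b) ≡ iverson q
occ-segment a zero q q⇔ rewrite segment-≥ {a} z≤n = sym (iverson-¬T (λ t → let (a<i , i≤0) = to q⇔ t in <⇒≱ a<i (≤-trans i≤0 z≤n)))
occ-segment a (suc b) {i} q q⇔ with a ≤? b
... | no a≰b rewrite segment-≥ (≰⇒> a≰b) = sym (iverson-¬T (λ t → let (a<i , i≤1+b) = to q⇔ t in <⇒≱ a<i (≤-trans i≤1+b (≰⇒> a≰b))))
... | yes a≤b rewrite segment-suc a≤b | count-∷ (_≡ᵇ i) (suc b) (segment a b) with suc b ≟ i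
...   | yes refl = begin
  iverson (suc b ≡ᵇ suc b) + occ (suc b) (segment a b) ≡⟨ cong₂ _+_ (iverson-T (≡⇒≡ᵇ (suc b) (suc b) refl)) (occ-segment a b false (mk⇔ (λ ()) (λ (_ , i≤b) → 1+n≰n i≤b))) ⟩
  1                                                   ≡⟨ iverson-T (from q⇔ (s≤s a≤b , ≤-refl)) ⟨
  iverson q                                           ∎
  where open ≡-Reasoning
...   | no 1+b≢i = begin
  iverson (suc b ≡ᵇ i) + occ i (segment a b) ≡⟨ cong (_+ occ i (segment a b)) (iverson-¬T (1+b≢i ∘ ≡ᵇ⇒≡ (suc b) i)) ⟩
  occ i (segment a b)                        ≡⟨ occ-segment a b q (mk⇔ (λ t → let (a<i , i≤1+b) = to q⇔ t in a<i , ≤-pred (≤∧≢⇒< i≤1+b (1+b≢i ∘ sym))) (λ (a<i , i≤b) → from q⇔ (a<i , m≤n⇒m≤1+n i≤b))) ⟩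
  iverson q                                  ∎
  where open ≡-Reasoning

blocks : (ℕ → List ℕ) → ℕ → List ℕ
blocks g zero    = []
blocks g (suc n) = blocks g n ++ g n

concatMap-range : ∀ (f : ℕ → List ℕ) n → concatMap f (range n) ≡ blocks (f ∘ suc) n
concatMap-range f zero    = refl
concatMap-range f (suc n) = begin
  concatMap f (range (suc n))                     ≡⟨ cong (concatMap f) (range-suc n) ⟩
  concat (map f (range n ∷ʳ suc n))               ≡⟨ cong concat (map-++ f (range n) [ suc n ]) ⟩
  concat (map f (range n) ++ [ f (suc n) ])       ≡⟨ concat-++ (map f (range n)) [ f (suc n) ] ⟨
  concatMap f (range n) ++ (f (suc n) ++ [])      ≡⟨ cong₂ _++_ (concatMap-range f n) (++-identityʳ (f (suc n))) ⟩
  blocks (f ∘ suc) (suc n)                        ∎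
  where open ≡-Reasoning

reverse-concatMap-descending : ∀ (f : ℕ → List ℕ) n → reverse (concatMap f (descending n)) ≡ blocks (reverse ∘ f ∘ suc) n
reverse-concatMap-descending f zero    = refl
reverse-concatMap-descending f (suc n) = trans (reverse-++ (f (suc n)) _) (cong (_++ reverse (f (suc n))) (reverse-concatMap-descending f n))

blocks-cong : ∀ {g h} n → (∀ k → k < n → g k ≡ h k) → blocks g n ≡ blocks h n
blocks-cong zero    _   = refl
blocks-cong (suc n) g≡h = cong₂ _++_ (blocks-cong n (λ k k<n → g≡h k (m≤n⇒m≤1+n k<n))) (g≡h n ≤-refl)

blocks-suc : ∀ g n → blocks g (suc n) ≡ g 0 ++ blocks (g ∘ suc) n
blocks-suc g zero    = sym (++-identityʳ (g 0))
blocks-suc g (suc n) = trans (cong (_++ g (suc n)) (blocks-suc g n)) (++-assoc (g 0) _ _)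

blocks-padding : ∀ g {n m} → (∀ k → n ≤ k → g k ≡ []) → n ≤ m → blocks g m ≡ blocks g n
blocks-padding g {n} {m} empty n≤m with n ≟ m
... | yes refl = refl
blocks-padding g {n} {suc m} empty n≤1+m | no n≢1+m = begin
  blocks g m ++ g m ≡⟨ cong (blocks g m ++_) (empty m n≤m) ⟩
  blocks g m ++ []  ≡⟨ ++-identityʳ (blocks g m) ⟩
  blocks g m        ≡⟨ blocks-padding g empty n≤m ⟩
  blocks g n        ∎
  where
  open ≡-Reasoning
  n≤m = ≤-pred (≤∧≢⇒< n≤1+m n≢1+m)
blocks-padding g {n} {zero} empty z≤n | no n≢0 = ⊥-elim (n≢0 refl)

count-blocks : ∀ p g (q : ℕ → Bool) → (∀ k → count p (g k) ≡ iverson (q k)) → ∀ n → count p (blocks g n) ≡ countBelow q n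
count-blocks p g q countₖ zero    = refl
count-blocks p g q countₖ (suc n) = trans (count-++ p (blocks g n) (g n)) (cong₂ _+_ (count-blocks p g q countₖ n) (countₖ n))

take-++-cases : ∀ {A : Set} m (xs ys : List A) → take m (xs ++ ys) ≡ take m xs ⊎ ∃[ r ] take m (xs ++ ys) ≡ xs ++ take r ys
take-++-cases zero    xs       ys = inj₁ refl
take-++-cases (suc m) []       ys = inj₂ (suc m , refl)
take-++-cases (suc m) (x ∷ xs) ys = Sum.map (cong (x ∷_)) (λ (r , eq) → r , cong (x ∷_) eq) (take-++-cases m xs ys)

count-take-blocks : ∀ p q g → (∀ N → count p (blocks g (suc N)) ≤ count q (blocks g N)) →
  ∀ n m → count p (take m (blocks g n)) ≤ count q (take m (blocks g n))
count-take-blocks p q g step zero    m rewrite take-[] {A = ℕ} m = z≤n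
count-take-blocks p q g step (suc n) m with take-++-cases m (blocks g n) (g n)
... | inj₁ eq rewrite eq = count-take-blocks p q g step n m
... | inj₂ (r , eq) rewrite eq = begin
  count p (blocks g n ++ take r (g n))           ≡⟨ count-++ p (blocks g n) (take r (g n)) ⟩
  count p (blocks g n) + count p (take r (g n))  ≤⟨ +-monoʳ-≤ (count p (blocks g n)) (count-take p r (g n)) ⟩
  count p (blocks g n) + count p (g n)           ≡⟨ count-++ p (blocks g n) (g n) ⟨
  count p (blocks g (suc n))                     ≤⟨ step n ⟩
  count q (blocks g n)                           ≤⟨ m≤m+n _ _ ⟩
  count q (blocks g n) + count q (take r (g n))  ≡⟨ count-++ q (blocks g n) (take r (g n)) ⟨
  count q (blocks g n ++ take r (g n))           ∎
  where open ≤-Reasoning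

-- The filling of ν/ν̲

module Filling (ν : List ℕ) (ν-partition : IsPartition ν) where

  n : ℕ
  n = length ν

  -- row k is ν_{k+1}: rows are counted from 0 here.
  row : ℕ → ℕ
  row k = at ν (suc k)

  row-≥ : ∀ {k} → n ≤ k → row k ≡ 0
  row-≥ = at₀-≥ ν

  -- reaches y k holds iff ν_j − j ≥ −y for j = k + 1, the condition counted by ν̄_y.
  reaches : ℕ → ℕ → Bool
  reaches y k = suc k ≤ᵇ row k + y

  reaches-closed : ∀ y → DownwardClosed (reaches y)
  reaches-closed y k t = ≤⇒≤ᵇ (≤-trans (n≤1+n (suc k)) (≤-trans (≤ᵇ⇒≤ _ _ t) (+-monoˡ-≤ y (ν-partition k))))

  reaches≡ : ∀ y k .{{_ : ℕ.NonZero y}} → reaches y k ≡ (suc (k ∸ row k) ≤ᵇ y)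
  reaches≡ y k = ≤ᵇ-≡ (<+⇔∸< k (row k) y)

  nuBar-< : ∀ {y} → y < n → at (nuBar ν) (suc y) + suc y ≡ countBelow (reaches (suc y)) n
  nuBar-< {y} y<n = begin
    at (nuBar ν) (suc y) + suc y          ≡⟨ cong (_+ suc y) (at-map-range _ y<n) ⟩
    ∣ starλ n [] ν (suc y) ∣ + suc y      ≡⟨ cong (λ m → ∣ (+ 0 ℤ.- + suc y) ℤ.+ + m ∣ + suc y) counted ⟩
    ∣ (+ 0 ℤ.- + suc y) ℤ.+ + C ∣ + suc y ≡⟨ cong (_+ suc y) (∣[+a-+b]+c∣ 0 (suc y) C y<C) ⟩
    C ∸ suc y + suc y                     ≡⟨ m∸n+n≡m y<C ⟩
    C                                     ∎
    where
    open ≡-Reasoning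
    open ℤ using (+_)
    C = countBelow (reaches (suc y)) n
    y<C : y < C
    y<C = T⇒<countBelow (reaches-closed (suc y)) y<n (≤⇒≤ᵇ (m≤n+m (suc y) (row y)))
    counted : count (λ j → shifted [] (suc y) ℤ.≤ᵇ shifted ν j) (range n) ≡ C
    counted = trans (count-range _ n) (countBelow-cong n (λ k _ → [+a-+b]≤ᵇ[+c-+d] 0 (suc y) (row k) (suc k)))

  nuBar-≥ : ∀ {y} → n ≤ y → at (nuBar ν) (suc y) ≡ 0
  nuBar-≥ = at-map-range-≥ _

  nuUnder-< : ∀ {k} → k < n → at (nuUnder ν) (suc k) ≡ row k ∸ k
  nuUnder-< {k} k<n = begin
    at (nuUnder ν) (suc k)                            ≡⟨ at-map-range _ k<n ⟩
    ∣ starρ n [] ν (suc k) ∣                          ≡⟨ cong (λ m → ∣ shifted ν (suc k) ℤ.+ + 1 ℤ.+ + m ∣) counted ⟩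
    ∣ (+ row k ℤ.- + suc k) ℤ.+ + 1 ℤ.+ + L ∣         ≡⟨ cong (λ z → ∣ z ℤ.+ + L ∣) (add-one (+ row k) (+ suc k)) ⟩
    ∣ (+ suc (row k) ℤ.- + suc k) ℤ.+ + L ∣           ≡⟨ ∣[+a-+b]+c∣ (suc (row k)) (suc k) L (s≤s (m≤n+m∸n k (row k))) ⟩
    row k + (k ∸ row k) ∸ k                           ≡⟨ [m+[n∸m]]∸n≡m∸n (row k) k ⟩
    row k ∸ k                                         ∎
    where
    open ≡-Reasoning
    open ℤ using (+_)
    L = k ∸ row k
    add-one : ∀ (a b : ℤ.ℤ) → a ℤ.- b ℤ.+ + 1 ≡ + 1 ℤ.+ a ℤ.- b
    add-one = solve-∀
    counted : count (λ j → shifted ν (suc k) ℤ.+ + 1 ℤ.≤ᵇ shifted [] j) (range n) ≡ L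
    counted = trans (count-range _ n) (trans (countBelow-cong n below) (countBelow-< L n (≤-trans (m∸n≤m k (row k)) (<⇒≤ k<n))))
      where
      below : ∀ j → j < n → (shifted ν (suc k) ℤ.+ + 1 ℤ.≤ᵇ shifted [] (suc j)) ≡ (suc j ≤ᵇ L)
      below j _ = begin
        (+ row k ℤ.- + suc k) ℤ.+ + 1 ℤ.≤ᵇ (+ 0 ℤ.- + suc j) ≡⟨ cong (ℤ._≤ᵇ (+ 0 ℤ.- + suc j)) (add-one (+ row k) (+ suc k)) ⟩
        (+ suc (row k) ℤ.- + suc k) ℤ.≤ᵇ (+ 0 ℤ.- + suc j)   ≡⟨ [+a-+b]≤ᵇ[+c-+d] (suc (row k)) (suc k) 0 (suc j) ⟩
        suc (row k + suc j) ≤ᵇ suc k                         ≡⟨ ≤ᵇ-≡ (mk⇔ (λ r+j<k → subst (_≤ k) (+-comm (row k) (suc j)) (≤-pred r+j<k))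
                                                                       (λ j+r≤k → s≤s (subst (_≤ k) (+-comm (suc j) (row k)) j+r≤k))) ⟩
        suc j + row k ≤ᵇ k                                   ≡⟨ ≤ᵇ-≡ (m+n≤o⇔m≤o∸n (suc j) (row k) k) ⟩
        suc j ≤ᵇ L                                           ∎

  filling : ℕ → ℕ → ℕ
  filling x y = x + (y ∸ 1) ∸ at ν y

  run : ℕ → List ℕ
  run k = segment (k ∸ row k) k

  run-≥ : ∀ {k} → n ≤ k → run k ≡ []
  run-≥ {k} n≤k rewrite row-≥ n≤k = segment-≥ ≤-refl

  rowWord : ℕ → List ℕ
  rowWord y = map (λ x → filling x y) (rowCells ν (nuUnder ν) y)

  reverse-rowWord : ∀ {k} → k < n → reverse (rowWord (suc k)) ≡ run k
  reverse-rowWord {k} k<n = begin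
    reverse (rowWord (suc k))
      ≡⟨ cong (λ u → reverse (map (λ x → filling x (suc k)) (map (λ i → u + i) (range (row k ∸ u))))) (nuUnder-< k<n) ⟩
    reverse (map (λ x → filling x (suc k)) (map (λ i → u + i) (range (row k ∸ u))))
      ≡⟨ cong reverse (map-∘ (range (row k ∸ u))) ⟨
    reverse (map (λ i → filling (u + i) (suc k)) (range (row k ∸ u)))
      ≡⟨ reverse-map _ (range (row k ∸ u)) ⟨
    map (λ i → filling (u + i) (suc k)) (reverse (range (row k ∸ u)))
      ≡⟨ cong (map _) (reverse-range (row k ∸ u)) ⟩
    map (λ i → filling (u + i) (suc k)) (descending (row k ∸ u))
      ≡⟨ map-cong (λ i → [m∸n+o+n]∸m≡o+[n∸m] (row k) k i) (descending (row k ∸ u)) ⟩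
    map (_+ (k ∸ row k)) (descending (row k ∸ u))
      ≡⟨ cong (λ m → map (_+ (k ∸ row k)) (descending m)) (trans (m∸[m∸n]≡n⊓m (row k) k) (trans (⊓-comm k (row k)) (sym (m∸[m∸n]≡n⊓m k (row k))))) ⟩
    run k
      ∎
    where
    open ≡-Reasoning
    u = row k ∸ k

  reverseReadingWord≡blocks : reverseReadingWord ν (nuUnder ν) filling ≡ blocks run n
  reverseReadingWord≡blocks = begin
    reverse (concatMap rowWord (reverse (range n))) ≡⟨ cong (reverse ∘ concatMap rowWord) (reverse-range n) ⟩
    reverse (concatMap rowWord (descending n))      ≡⟨ reverse-concatMap-descending rowWord n ⟩
    blocks (reverse ∘ rowWord ∘ suc) n              ≡⟨ blocks-cong n (λ k → reverse-rowWord) ⟩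
    blocks run n                                    ∎
    where open ≡-Reasoning

  diagonal-entry : ∀ {k y} → 1 ≤ y → y ≤ k → (suc k ≤ᵇ at (nuBar ν) y + y) ≡ reaches y k
  diagonal-entry {k} {suc y} _ y<k with y <? n
  ... | no  y≮n rewrite nuBar-≥ (≮⇒≥ y≮n) | row-≥ (≤-trans (≮⇒≥ y≮n) (<⇒≤ y<k)) = refl
  ... | yes y<n rewrite nuBar-< y<n = T-injective (mk⇔ to′ from′)
    where
    closed = reaches-closed (suc y)
    to′ : T (suc k ≤ᵇ countBelow (reaches (suc y)) n) → T (reaches (suc y) k)
    to′ t = decidable-stable (T? _) (λ ¬r → <⇒≱ (≤ᵇ⇒≤ _ _ t) (¬T⇒countBelow≤ closed n ¬r))
    from′ : T (reaches (suc y) k) → T (suc k ≤ᵇ countBelow (reaches (suc y)) n)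
    from′ r with k <? n
    ... | yes k<n = ≤⇒≤ᵇ (T⇒<countBelow closed k<n r)
    ... | no  k≮n = ⊥-elim (<⇒≱ y<k (≤-pred (subst (λ l → suc k ≤ l + suc y) (row-≥ (≮⇒≥ k≮n)) (≤ᵇ⇒≤ _ _ r))))

  diagonal≡run : ∀ k → diagonal (nuBar ν) k ≡ run k
  diagonal≡run k = begin
    filterᵇ (λ y → suc k ≤ᵇ at (nuBar ν) y + y) (reverse (range k)) ≡⟨ cong (filterᵇ _) (reverse-range k) ⟩
    filterᵇ (λ y → suc k ≤ᵇ at (nuBar ν) y + y) (descending k)      ≡⟨ filterᵇ-descending-cong _ _ k entry ⟩
    filterᵇ (λ y → suc (k ∸ row k) ≤ᵇ y) (descending k)              ≡⟨ filter-descending (k ∸ row k) k ⟩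
    run k                                                           ∎
    where
    open ≡-Reasoning
    entry : ∀ y → 1 ≤ y → y ≤ k → (suc k ≤ᵇ at (nuBar ν) y + y) ≡ (suc (k ∸ row k) ≤ᵇ y)
    entry (suc y) 1≤y y≤k = trans (diagonal-entry 1≤y y≤k) (reaches≡ (suc y) k)

  Δ≡blocks : Δ (nuBar ν) ≡ blocks run n
  Δ≡blocks = begin
    concatMap (diagonal (nuBar ν)) (range N) ≡⟨ concatMap-range (diagonal (nuBar ν)) N ⟩
    blocks (diagonal (nuBar ν) ∘ suc) N      ≡⟨ blocks-cong N (λ k _ → diagonal≡run (suc k)) ⟩
    blocks (run ∘ suc) N                     ≡⟨ cong (_++ blocks (run ∘ suc) N) (segment-≥ z≤n) ⟨
    run 0 ++ blocks (run ∘ suc) N            ≡⟨ blocks-suc run N ⟨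
    blocks run (suc N)                       ≡⟨ blocks-padding run (λ k → run-≥) n≤1+N ⟩
    blocks run n                             ∎
    where
    open ≡-Reasoning
    N = at (nuBar ν) 1 + length (nuBar ν)
    n≤1+N : n ≤ suc N
    n≤1+N = m≤n⇒m≤1+n (subst (λ l → n ≤ at (nuBar ν) 1 + l) (sym (length-map-range _ n)) (m≤n+m n _))

  inRun : ℕ → ℕ → Bool
  inRun i k = reaches i k ∧ (i ≤ᵇ k)

  occ-run : ∀ i k → occ (suc i) (run k) ≡ iverson (inRun (suc i) k)
  occ-run i k = occ-segment (k ∸ row k) k (inRun (suc i) k) (⇔-trans T-∧ (⇔-trans T-≤ᵇ (<+⇔∸< k (row k) (suc i)) ×-⇔ T-≤ᵇ))

  countBelow-inRun : ∀ i → countBelow (inRun (suc i)) n ≡ at (nuBar ν) (suc i)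
  countBelow-inRun i with i <? n
  ... | no  i≮n rewrite nuBar-≥ (≮⇒≥ i≮n) =
    countBelow-none _ n (λ k k<n t → <⇒≱ k<n (≤-trans (≮⇒≥ i≮n) (<⇒≤ (≤ᵇ⇒≤ (suc i) k (proj₂ (to T-∧ t))))))
  ... | yes i<n = +-cancelʳ-≡ (suc i) _ _ (begin
    countBelow (inRun (suc i)) n + suc i                                          ≡⟨ cong (countBelow (inRun (suc i)) n +_) below ⟨
    countBelow (inRun (suc i)) n + countBelow (λ k → reaches (suc i) k ∧ not (suc i ≤ᵇ k)) n ≡⟨ countBelow-split (reaches (suc i)) (suc i ≤ᵇ_) n ⟨
    countBelow (reaches (suc i)) n                                                ≡⟨ nuBar-< i<n ⟨
    at (nuBar ν) (suc i) + suc i                                                  ∎)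
    where
    open ≡-Reasoning
    outside : ∀ k → k < n → (reaches (suc i) k ∧ not (suc i ≤ᵇ k)) ≡ (suc k ≤ᵇ suc i)
    outside k _ with suc i ≤? k
    ... | yes i<k rewrite ≤ᵇ≡true i<k | ∧-zeroʳ (reaches (suc i) k) = sym (≤ᵇ≡false (<⇒≱ (s≤s i<k)))
    ... | no  i≮k rewrite ≤ᵇ≡false i≮k | ∧-identityʳ (reaches (suc i) k) =
      T-injective (mk⇔ (λ _ → ≤⇒≤ᵇ (≰⇒> i≮k)) (λ _ → ≤⇒≤ᵇ (≤-trans (≰⇒> i≮k) (m≤n+m (suc i) (row k)))))
    below : countBelow (λ k → reaches (suc i) k ∧ not (suc i ≤ᵇ k)) n ≡ suc i
    below = trans (countBelow-cong n outside) (countBelow-< (suc i) n i<n)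

  filling-type : HasType ν (nuUnder ν) filling (nuBar ν)
  filling-type (suc i) _ = begin
    occ (suc i) (readingWord ν (nuUnder ν) filling)        ≡⟨ count-reverse _ (readingWord ν (nuUnder ν) filling) ⟨
    occ (suc i) (reverseReadingWord ν (nuUnder ν) filling) ≡⟨ cong (occ (suc i)) reverseReadingWord≡blocks ⟩
    occ (suc i) (blocks run n)                             ≡⟨ count-blocks _ run (inRun (suc i)) (occ-run i) n ⟩
    countBelow (inRun (suc i)) n                           ≡⟨ countBelow-inRun i ⟩
    at (nuBar ν) (suc i)                                   ∎
    where open ≡-Reasoning

  inSkew⇒<n : ∀ {x k} → InSkew ν (nuUnder ν) x (suc k) → k < n
  inSkew⇒<n {x} {k} (_ , u<x , x≤row) with k <? n
  ... | yes k<n = k<n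
  ... | no  k≮n = ⊥-elim (<⇒≱ (≤-<-trans z≤n u<x) (subst (x ≤_) (row-≥ (≮⇒≥ k≮n)) x≤row))

  inSkew⇒row< : ∀ {x k} → InSkew ν (nuUnder ν) x (suc k) → row k < x + k
  inSkew⇒row< {x} {k} s@(_ , u<x , _) = subst (row k <_) (+-comm k x) (m∸n<o⇒m<n+o (row k) k (subst (_< x) (nuUnder-< (inSkew⇒<n s)) u<x))

  filling-semistandard : IsSemistandard ν (nuUnder ν) filling
  filling-semistandard = record
    { positive  = λ { x (suc k) s → m<n⇒0<n∸m (inSkew⇒row< s) }
    ; rowWeak   = λ x y _ _ → ∸-monoˡ-≤ (at ν y) (+-monoˡ-≤ (y ∸ 1) (n≤1+n x))
    ; colStrict = λ { x (suc k) s _ → column x k s }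
    }
    where
    column : ∀ x k → InSkew ν (nuUnder ν) x (suc k) → filling x (suc k) < filling x (suc (suc k))
    column x k s = begin-strict
      x + k ∸ row k               <⟨ n<1+n _ ⟩
      suc (x + k ∸ row k)         ≡⟨ +-∸-assoc 1 (<⇒≤ (inSkew⇒row< s)) ⟨
      suc (x + k) ∸ row k         ≤⟨ ∸-monoʳ-≤ (suc (x + k)) (ν-partition k) ⟩
      suc (x + k) ∸ row (suc k)   ≡⟨ cong (_∸ row (suc k)) (+-suc x k) ⟨
      x + suc k ∸ row (suc k)     ∎
      where open ≤-Reasoning

  inRun-shift : ∀ i k → T (inRun (suc i) (suc k)) → T (inRun i k)
  inRun-shift i k t with to T-∧ t
  ... | reach , i<k = from T-∧ (≤⇒≤ᵇ (≤-pred (begin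
    suc (suc k)               ≤⟨ ≤ᵇ⇒≤ _ _ reach ⟩
    row (suc k) + suc i       ≤⟨ +-monoˡ-≤ (suc i) (ν-partition k) ⟩
    row k + suc i             ≡⟨ +-suc (row k) i ⟩
    suc (row k + i)           ∎)) , ≤⇒≤ᵇ (≤-pred (≤ᵇ⇒≤ (suc i) (suc k) i<k)))
    where open ≤-Reasoning

  occ-blocks-suc-≤ : ∀ i N → occ (suc (suc i)) (blocks run (suc N)) ≤ occ (suc i) (blocks run N)
  occ-blocks-suc-≤ i N = begin
    occ (suc (suc i)) (blocks run (suc N))                    ≡⟨ count-blocks _ run (inRun (suc (suc i))) (occ-run (suc i)) (suc N) ⟩
    countBelow (inRun (suc (suc i))) (suc N)                  ≡⟨ countBelow-suc (inRun (suc (suc i))) N ⟩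
    iverson (inRun (suc (suc i)) 0) + countBelow (inRun (suc (suc i)) ∘ suc) N
                                                              ≡⟨ cong (λ b → iverson b + countBelow (inRun (suc (suc i)) ∘ suc) N) (∧-zeroʳ _) ⟩
    countBelow (inRun (suc (suc i)) ∘ suc) N                  ≤⟨ countBelow-mono N (λ k _ → inRun-shift (suc i) k) ⟩
    countBelow (inRun (suc i)) N                              ≡⟨ count-blocks _ run (inRun (suc i)) (occ-run i) N ⟨
    occ (suc i) (blocks run N)                                ∎
    where open ≤-Reasoning

  filling-lattice : IsLatticePermutation (reverseReadingWord ν (nuUnder ν) filling)
  filling-lattice m (suc i) _ rewrite reverseReadingWord≡blocks = count-take-blocks _ _ run (occ-blocks-suc-≤ i) n m

lemma7p1 : (ν : List ℕ) → IsPartition ν →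
    Σ (ℕ → ℕ → ℕ) (λ T →
      IsLRFilling ν (nuUnder ν) T
      × HasType ν (nuUnder ν) T (nuBar ν)
      × reverseReadingWord ν (nuUnder ν) T ≡ Δ (nuBar ν))
lemma7p1 ν ν-partition =
    filling
  , record { semistandard = filling-semistandard ; lattice = filling-lattice }
  , filling-type
  , trans reverseReadingWord≡blocks (sym Δ≡blocks)
  where open Filling ν ν-partition
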